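{- Let $F$ be either $\mathbb{Z}/m\mathbb{Z}$ (for a fixed positive integer $m$) or $\mathbb{Q}$, let $M$ be an $F$-module, $s$ a positive integer, $A=\{a_1,\dots,a_k\}\subset M$ with $\operatorname{card}(A)=k$, and let $A_{r,s}=\{\bar e_1,\dots,\bar e_k\}\subset F^k/\langle R_s(A)\rangle$ be as defined below. Let $H$ be an $F$-module. Then every Freiman $s$-homomorphism $g:A_{r,s}\to H$ extends to an $F$-linear map $\tilde g:\langle A_{r,s}\rangle\to H$, and the map $g\mapsto\tilde g$ is an isomorphism of $F$-modules from $\mathrm{Hom}_s(A_{r,s},H)$ onto $\mathrm{Hom}_F(\langle A_{r,s}\rangle,H)$.
   Context: Let $e_1,\dots,e_k$ be the canonical basis of $F^k$, $\phi:F^k\to M$ the $F$-linear map with $\phi(e_i)=a_i$, $R_s\subset F^k$ the set of elements $e_{i_1}+\dots+e_{i_s}-e_{j_1}-\dots-e_{j_s}$ (indices not necessarily distinct), $R_s(A)=R_s\cap\ker\phi$, and $\bar e_i$ the image of $e_i$ in $F^k/\langle R_s(A)\rangle$; $\langle X\rangle$ denotes the $F$-submodule generated by $X$ (so $\langle A_{r,s}\rangle=F^k/\langle R_s(A)\rangle$). A map $\psi$ between subsets of abelian groups is a Freiman $s$-homomorphism if $a_1+\dots+a_s=a_1'+\dots+a_s'$ implies $\psi(a_1)+\dots+\psi(a_s)=\psi(a_1')+\dots+\psi(a_s')$. $\mathrm{Hom}_s(A_{r,s},H)$ is the $F$-module of Freiman $s$-homomorphisms $A_{r,s}\to H$ (with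 pointwise operations), and $\mathrm{Hom}_F(\langle A_{r,s}\rangle,H)$ is the $F$-module of $F$-linear maps. -}

module Defs where

open import Level using (Level; _⊔_; 0ℓ)
open import Data.Nat as ℕ using (ℕ; zero; suc)
open import Data.Fin using (Fin; _≟_)
open import Data.Integer as ℤ using (ℤ; +_)
import Data.Integer.Properties as ℤP
open import Data.Integer.Divisibility.Signed
  using (_∣_; ∣-refl; ∣-trans; ∣m∣n⇒∣m+n; ∣m⇒∣-m; ∣n⇒∣m*n; ∣m⇒∣m*n; ∣-reflexive)
import Data.Rational.Properties as ℚP
open import Data.Product using (Σ; _×_; _,_)
open import Relation.Nullary using (yes; no)
open import Relation.Binary.PropositionalEquality as ≡ using (_≡_)
open import Algebra.Bundles using (CommutativeRing)
open import Algebra.Structures using (IsCommutativeRing)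
open import Algebra.Module.Bundles using (Module)

-- The ring ℤ/mℤ, realised as ℤ with the setoid equality
--   x ≈ y  :⇔  (+ m) ∣ (x - y)

module ZMod (m : ℕ) where

  open import Data.Integer using (_+_; _-_; -_; _*_)

  infix 4 _≈_
  record _≈_ (x y : ℤ) : Set where
    constructor ≈i
    field prf : (+ m) ∣ (x - y)

  private
    ∣0 : (+ m) ∣ (+ 0)
    ∣0 = ∣-trans (∣-refl {+ m}) (Data.Integer.Divisibility.Signed.divides (+ 0) (≡.sym (ℤP.*-zeroˡ (+ m))))
      where import Data.Integer.Divisibility.Signed

  lift : ∀ {x y} → x ≡ y → x ≈ y
  lift {x} ≡.refl = ≈i (≡.subst ((+ m) ∣_) (≡.sym (ℤP.+-inverseʳ x)) ∣0)

  ≈-refl : ∀ {x} → x ≈ x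
  ≈-refl = lift ≡.refl

  ≈-sym : ∀ {x y} → x ≈ y → y ≈ x
  ≈-sym {x} {y} (≈i p) = ≈i (≡.subst ((+ m) ∣_) eq (∣m⇒∣-m p))
    where
    eq : - (x - y) ≡ y - x
    eq = ≡.trans (ℤP.neg-distrib-+ x (- y))
         (≡.trans (≡.cong (λ t' → (- x) + t') (ℤP.neg-involutive y)) (ℤP.+-comm (- x) y))

  ≈-trans : ∀ {x y z} → x ≈ y → y ≈ z → x ≈ z
  ≈-trans {x} {y} {z} (≈i p) (≈i q) = ≈i (≡.subst ((+ m) ∣_) eq (∣m∣n⇒∣m+n p q))
    where
    open ≡.≡-Reasoning
    eq : (x - y) + (y - z) ≡ x - z
    eq = begin
      (x - y) + (y - z)     ≡⟨ ℤP.+-assoc x (- y) (y - z) ⟩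
      x + (- y + (y - z)) ≡⟨ ≡.cong (λ t' → x + t') (≡.sym (ℤP.+-assoc (- y) y (- z))) ⟩
      x + ((- y + y) - z) ≡⟨ ≡.cong (λ t → x + (t - z)) (ℤP.+-inverseˡ y) ⟩
      x + (+ 0 - z)           ≡⟨ ≡.cong (λ t' → x + t') (ℤP.+-identityˡ (- z)) ⟩
      x - z ∎

  +-cong : ∀ {x y u v} → x ≈ y → u ≈ v → x + u ≈ y + v
  +-cong {x} {y} {u} {v} (≈i p) (≈i q) = ≈i (≡.subst ((+ m) ∣_) eq (∣m∣n⇒∣m+n p q))
    where
    open ≡.≡-Reasoning
    eq : (x - y) + (u - v) ≡ (x + u) - (y + v)
    eq = begin
      (x - y) + (u - v)         ≡⟨ ℤP.+-assoc x (- y) (u - v) ⟩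
      x + (- y + (u - v))     ≡⟨ ≡.cong (λ t' → x + t') (≡.sym (ℤP.+-assoc (- y) u (- v))) ⟩
      x + ((- y + u) - v)     ≡⟨ ≡.cong (λ t → x + (t - v)) (ℤP.+-comm (- y) u) ⟩
      x + ((u - y) - v)         ≡⟨ ≡.cong (λ t' → x + t') (ℤP.+-assoc u (- y) (- v)) ⟩
      x + (u + (- y - v))     ≡⟨ ≡.sym (ℤP.+-assoc x u (- y - v)) ⟩
      (x + u) + (- y - v)     ≡⟨ ≡.cong (λ t' → (x + u) + t') (≡.sym (ℤP.neg-distrib-+ y v)) ⟩
      (x + u) - (y + v) ∎

  neg-cong : ∀ {x y} → x ≈ y → - x ≈ - y
  neg-cong {x} {y} (≈i p) = ≈-sym (≈i (≡.subst ((+ m) ∣_) eq p))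
    where
    eq : x - y ≡ - y - - x
    eq = ≡.trans (ℤP.+-comm x (- y)) (≡.cong (λ t' → (- y) + t') (≡.sym (ℤP.neg-involutive x)))

  *-cong : ∀ {x y u v} → x ≈ y → u ≈ v → x * u ≈ y * v
  *-cong {x} {y} {u} {v} (≈i p) (≈i q) = ≈i (≡.subst ((+ m) ∣_) eq (∣m∣n⇒∣m+n (∣n⇒∣m*n x q) (∣m⇒∣m*n v p)))
    where
    open ≡.≡-Reasoning
    eq : x * (u - v) + (x - y) * v ≡ x * u - y * v
    eq = begin
      x * (u - v) + (x - y) * v
        ≡⟨ ≡.cong₂ _+_ (ℤP.*-distribˡ-+ x u (- v)) (ℤP.*-distribʳ-+ v x (- y)) ⟩
      (x * u + x * - v) + (x * v + - y * v)
        ≡⟨ ≡.cong₂ (λ a b → (x * u + a) + (x * v + b)) (≡.sym (ℤP.neg-distribʳ-* x v)) (≡.sym (ℤP.neg-distribˡ-* y v)) ⟩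
      (x * u - x * v) + (x * v - y * v)
        ≡⟨ ℤP.+-assoc (x * u) (- (x * v)) (x * v - y * v) ⟩
      x * u + (- (x * v) + (x * v - y * v))
        ≡⟨ ≡.cong (λ t' → x * u + t') (≡.sym (ℤP.+-assoc (- (x * v)) (x * v) (- (y * v)))) ⟩
      x * u + ((- (x * v) + x * v) - y * v)
        ≡⟨ ≡.cong (λ t → x * u + (t - y * v)) (ℤP.+-inverseˡ (x * v)) ⟩
      x * u + (+ 0 - y * v)
        ≡⟨ ≡.cong (λ t' → x * u + t') (ℤP.+-identityˡ (- (y * v))) ⟩
      x * u - y * v ∎

  isCommutativeRing : IsCommutativeRing _≈_ _+_ _*_ -_ (+ 0) (+ 1)
  isCommutativeRing = record
    { isRing = record
      { +-isAbelianGroup = record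
        { isGroup = record
          { isMonoid = record
            { isSemigroup = record
              { isMagma = record
                { isEquivalence = record { refl = ≈-refl ; sym = ≈-sym ; trans = ≈-trans }
                ; ∙-cong = +-cong }
              ; assoc = λ x y z → lift (ℤP.+-assoc x y z) }
            ; identity = (λ x → lift (ℤP.+-identityˡ x)) , (λ x → lift (ℤP.+-identityʳ x)) }
          ; inverse = (λ x → lift (ℤP.+-inverseˡ x)) , (λ x → lift (ℤP.+-inverseʳ x))
          ; ⁻¹-cong = neg-cong }
        ; comm = λ x y → lift (ℤP.+-comm x y) }
      ; *-cong = *-cong
      ; *-assoc = λ x y z → lift (ℤP.*-assoc x y z)
      ; *-identity = (λ x → lift (ℤP.*-identityˡ x)) , (λ x → lift (ℤP.*-identityʳ x))
      ; distrib = (λ x y z → lift (ℤP.*-distribˡ-+ x y z)) , (λ x y z → lift (ℤP.*-distribʳ-+ x y z)) }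
    ; *-comm = λ x y → lift (ℤP.*-comm x y) }

  commutativeRing : CommutativeRing 0ℓ 0ℓ
  commutativeRing = record { isCommutativeRing = isCommutativeRing }

data Coeff : Set where
  zmod : (m : ℕ) → .{{ℕ.NonZero m}} → Coeff
  rat  : Coeff

ring : Coeff → CommutativeRing 0ℓ 0ℓ
ring (zmod m) = ZMod.commutativeRing m
ring rat      = ℚP.+-*-commutativeRing

module Construction
  {mM ℓM : Level}
  (F : CommutativeRing 0ℓ 0ℓ)
  (M : Module F mM ℓM)
  (k : ℕ) (a : Fin k → Module.Carrierᴹ M)   -- A = {a₁,…,a_k}, φ(eᵢ) = aᵢ
  (s : ℕ)
  where

  open CommutativeRing F using (Carrier; _≈_; _+_; _-_; _*_; 0#; 1#)
  open Module M using (Carrierᴹ; _≈ᴹ_; _+ᴹ_; _*ₗ_; 0ᴹ)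

  sumWith : ∀ {ℓ} {X : Set ℓ} → (X → X → X) → X → ∀ {n} → (Fin n → X) → X
  sumWith _⊕_ z {zero}  f = z
  sumWith _⊕_ z {suc n} f = f Fin.zero ⊕ sumWith _⊕_ z (λ i → f (Fin.suc i))
    where import Data.Fin as Fin

  Fk : Set
  Fk = Fin k → Carrier

  e : Fin k → Fk
  e i j with i ≟ j
  ... | yes _ = 1#
  ... | no  _ = 0#

  _⊕_ : Fk → Fk → Fk
  (x ⊕ y) j = x j + y j

  _⊖_ : Fk → Fk → Fk
  (x ⊖ y) j = x j - y j

  _⊙_ : Carrier → Fk → Fk
  (c ⊙ x) j = c * x j

  𝟘 : Fk
  𝟘 _ = 0#

  φ : Fk → Carrierᴹ
  φ x = sumWith _+ᴹ_ 0ᴹ (λ l → x l *ₗ a l)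

  r : (Fin s → Fin k) → (Fin s → Fin k) → Fk
  r i j = sumWith _⊕_ 𝟘 (λ t → e (i t)) ⊖ sumWith _⊕_ 𝟘 (λ t → e (j t))

  -- membership in ⟨R_s(A)⟩, the F-submodule of F^k generated by R_s ∩ ker φ
  data InSpan : Fk → Set (mM ⊔ ℓM) where
    gen   : (i j : Fin s → Fin k) → φ (r i j) ≈ᴹ 0ᴹ → InSpan (r i j)
    zer   : InSpan 𝟘
    add   : ∀ {x y} → InSpan x → InSpan y → InSpan (x ⊕ y)
    scale : ∀ c {x} → InSpan x → InSpan (c ⊙ x)
    resp  : ∀ {x y} → (∀ l → x l ≈ y l) → InSpan x → InSpan y

  -- the equality of the quotient ⟨A_{r,s}⟩ = F^k / ⟨R_s(A)⟩
  infix 4 _∼_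
  _∼_ : Fk → Fk → Set (mM ⊔ ℓM)
  x ∼ y = InSpan (x ⊖ y)

  -- ēᵢ is the class of eᵢ; A_{r,s} = {ē₁,…,ē_k}

  module _ {mH ℓH : Level} (H : Module F mH ℓH) where
    open Module H renaming
      (Carrierᴹ to Cᴴ; _≈ᴹ_ to _≈ᴴ_; _+ᴹ_ to _+ᴴ_; _*ₗ_ to _*ᴴ_; 0ᴹ to 0ᴴ)

    sumᴴ : ∀ {n} → (Fin n → Cᴴ) → Cᴴ
    sumᴴ = sumWith _+ᴴ_ 0ᴴ

    -- Freiman s-homomorphism A_{r,s} → H (g given by its values g(ēᵢ))
    record FreimanHom : Set (mM ⊔ ℓM ⊔ mH ⊔ ℓH) where
      field
        fun     : Fin k → Cᴴ
        freiman : (i j : Fin s → Fin k) →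
                  sumWith _⊕_ 𝟘 (λ t → e (i t)) ∼ sumWith _⊕_ 𝟘 (λ t → e (j t)) →
                  sumᴴ (λ t → fun (i t)) ≈ᴴ sumᴴ (λ t → fun (j t))

    record LinearMap : Set (mM ⊔ ℓM ⊔ mH ⊔ ℓH) where
      field
        fun      : Fk → Cᴴ
        wellDef  : ∀ {x y} → x ∼ y → fun x ≈ᴴ fun y
        additive : ∀ x y → fun (x ⊕ y) ≈ᴴ fun x +ᴴ fun y
        homog    : ∀ c x → fun (c ⊙ x) ≈ᴴ c *ᴴ fun x

module Submission where

-- Write ⟨A_{r,s}⟩ = F^k/⟨R_s(A)⟩ and let g : A_{r,s} → H be given by its
-- values vᵢ = g(ēᵢ).  The extension is the linear combination
--     g̃(x) = Σₗ xₗ · vₗ ,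
-- which is linear on F^k and sends eᵢ to vᵢ.  It vanishes on every generator
-- r = e_{i₁}+…+e_{i_s} − e_{j₁}−…−e_{j_s} of ⟨R_s(A)⟩: since r ∈ ker φ the two
-- sums of basis vectors are congruent, so the Freiman property gives
-- Σ v_{i_t} = Σ v_{j_t}.  A linear map vanishing on the generators vanishes on
-- the whole submodule, hence g̃ is well defined on the quotient.  The map
-- g ↦ g̃ is F-linear because linear combinations are linear in the vectors,
-- injective because g̃(eᵢ) = vᵢ, and surjective because every linear map L is
-- the linear combination of its values L(eₗ) (expansion in the basis eₗ).

open import Defs
open import Level using (Level; 0ℓ)
open import Data.Nat using (ℕ; zero; suc; _<_)
open import Data.Fin using (Fin; zero; suc)
open import Data.Fin.Properties using (suc-injective)
open import Data.Product using (Σ; _×_; _,_)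
open import Data.Empty using (⊥-elim)
open import Relation.Nullary using (yes; no; ¬_)
open import Relation.Binary.PropositionalEquality as ≡ using (_≡_)
open import Algebra.Bundles using (CommutativeRing; CommutativeMonoid)
open import Algebra.Module.Bundles using (Module)
import Algebra.Module.Construct.TensorUnit as TensorUnit
import Algebra.Properties.CommutativeSemigroup as CommutativeSemigroupProperties
import Algebra.Properties.Group as GroupProperties
import Relation.Binary.Reasoning.Setoid as SetoidReasoning

module Extension {mM ℓM : Level} (F : CommutativeRing 0ℓ 0ℓ) (M : Module F mM ℓM)
                 (k : ℕ) (a : Fin k → Module.Carrierᴹ M) (s : ℕ) where

  open Construction F M k a s
  open CommutativeRing F using (Carrier; _≈_; _+_; _*_; 0#; 1#)
  module F = CommutativeRing F

  module Combination {m ℓ : Level} (N : Module F m ℓ) where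
    open Module N
    open CommutativeSemigroupProperties
      (CommutativeMonoid.commutativeSemigroup +ᴹ-commutativeMonoid)
      using (interchange)

    ∑ : ∀ {n} → (Fin n → Carrierᴹ) → Carrierᴹ
    ∑ = sumWith _+ᴹ_ 0ᴹ

    ∑-cong : ∀ {n} {f g : Fin n → Carrierᴹ} → (∀ i → f i ≈ᴹ g i) → ∑ f ≈ᴹ ∑ g
    ∑-cong {zero}  f≈g = ≈ᴹ-refl
    ∑-cong {suc n} f≈g = +ᴹ-cong (f≈g zero) (∑-cong (λ i → f≈g (suc i)))

    ∑-+ : ∀ {n} (f g : Fin n → Carrierᴹ) → ∑ (λ i → f i +ᴹ g i) ≈ᴹ ∑ f +ᴹ ∑ g
    ∑-+ {zero}  f g = ≈ᴹ-sym (+ᴹ-identityˡ 0ᴹ)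
    ∑-+ {suc n} f g = ≈ᴹ-trans (+ᴹ-cong ≈ᴹ-refl (∑-+ (λ i → f (suc i)) (λ i → g (suc i))))
                               (interchange (f zero) (g zero) _ _)

    ∑-*ₗ : ∀ {n} c (f : Fin n → Carrierᴹ) → ∑ (λ i → c *ₗ f i) ≈ᴹ c *ₗ ∑ f
    ∑-*ₗ {zero}  c f = ≈ᴹ-sym (*ₗ-zeroʳ c)
    ∑-*ₗ {suc n} c f = ≈ᴹ-trans (+ᴹ-cong ≈ᴹ-refl (∑-*ₗ c (λ i → f (suc i))))
                                (≈ᴹ-sym (*ₗ-distribˡ c (f zero) _))

    ∑-zero : ∀ {n} (f : Fin n → Carrierᴹ) → (∀ i → f i ≈ᴹ 0ᴹ) → ∑ f ≈ᴹ 0ᴹ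
    ∑-zero {zero}  f f≈0 = ≈ᴹ-refl
    ∑-zero {suc n} f f≈0 = ≈ᴹ-trans (+ᴹ-cong (f≈0 zero) (∑-zero (λ i → f (suc i)) (λ i → f≈0 (suc i))))
                                    (+ᴹ-identityˡ 0ᴹ)

    combine : ∀ {n} → (Fin n → Carrierᴹ) → (Fin n → Carrier) → Carrierᴹ
    combine v x = ∑ (λ l → x l *ₗ v l)

    combine-cong : ∀ {n} (v : Fin n → Carrierᴹ) {x y : Fin n → Carrier} →
                   (∀ l → x l ≈ y l) → combine v x ≈ᴹ combine v y
    combine-cong v x≈y = ∑-cong (λ l → *ₗ-cong (x≈y l) ≈ᴹ-refl)

    combine-+ : ∀ {n} (v : Fin n → Carrierᴹ) (x y : Fin n → Carrier) →
                combine v (λ l → x l + y l) ≈ᴹ combine v x +ᴹ combine v y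
    combine-+ v x y = ≈ᴹ-trans (∑-cong (λ l → *ₗ-distribʳ (v l) (x l) (y l)))
                               (∑-+ (λ l → x l *ₗ v l) (λ l → y l *ₗ v l))

    combine-* : ∀ {n} (v : Fin n → Carrierᴹ) c (x : Fin n → Carrier) →
                combine v (λ l → c * x l) ≈ᴹ c *ₗ combine v x
    combine-* v c x = ≈ᴹ-trans (∑-cong (λ l → *ₗ-assoc c (x l) (v l)))
                               (∑-*ₗ c (λ l → x l *ₗ v l))

    combine-+ᵥ : ∀ {n} (v w u : Fin n → Carrierᴹ) → (∀ l → u l ≈ᴹ v l +ᴹ w l) →
                 ∀ x → combine u x ≈ᴹ combine v x +ᴹ combine w x
    combine-+ᵥ v w u u≈v+w x =
      ≈ᴹ-trans (∑-cong (λ l → ≈ᴹ-trans (*ₗ-cong F.refl (u≈v+w l)) (*ₗ-distribˡ (x l) (v l) (w l))))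
               (∑-+ (λ l → x l *ₗ v l) (λ l → x l *ₗ w l))

    combine-*ᵥ : ∀ {n} c (v u : Fin n → Carrierᴹ) → (∀ l → u l ≈ᴹ c *ₗ v l) →
                 ∀ x → combine u x ≈ᴹ c *ₗ combine v x
    combine-*ᵥ c v u u≈cv x =
      ≈ᴹ-trans (∑-cong (λ l → ≈ᴹ-trans (*ₗ-cong F.refl (u≈cv l)) (*ₗ-comm (x l) c (v l))))
               (∑-*ₗ c (λ l → x l *ₗ v l))

    combine-delta : ∀ {n} (v : Fin n → Carrierᴹ) (δ : Fin n → Carrier) (i : Fin n) →
                    δ i ≈ 1# → (∀ l → ¬ i ≡ l → δ l ≈ 0#) → combine v δ ≈ᴹ v i
    combine-delta v δ zero δi≈1 δl≈0 =
      ≈ᴹ-trans (+ᴹ-cong (≈ᴹ-trans (*ₗ-cong δi≈1 ≈ᴹ-refl) (*ₗ-identityˡ (v zero)))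
                        (∑-zero _ (λ l → ≈ᴹ-trans (*ₗ-cong (δl≈0 (suc l) (λ ())) ≈ᴹ-refl) (*ₗ-zeroˡ _))))
               (+ᴹ-identityʳ (v zero))
    combine-delta v δ (suc i) δi≈1 δl≈0 =
      ≈ᴹ-trans (+ᴹ-cong (≈ᴹ-trans (*ₗ-cong (δl≈0 zero (λ ())) ≈ᴹ-refl) (*ₗ-zeroˡ _))
                        (combine-delta (λ l → v (suc l)) (λ l → δ (suc l)) i δi≈1
                                       (λ l i≢l → δl≈0 (suc l) (λ eq → i≢l (suc-injective eq)))))
               (+ᴹ-identityˡ (v (suc i)))

  infix 4 _≐_
  _≐_ : Fk → Fk → Set
  x ≐ y = ∀ l → x l ≈ y l

  e-same : ∀ i → e i i ≈ 1#
  e-same i with i Data.Fin.≟ i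
  ... | yes _   = F.refl
  ... | no i≢i = ⊥-elim (i≢i ≡.refl)

  e-other : ∀ i l → ¬ i ≡ l → e i l ≈ 0#
  e-other i l i≢l with i Data.Fin.≟ l
  ... | yes i≡l = ⊥-elim (i≢l i≡l)
  ... | no _    = F.refl

  ∑-coordinate : ∀ {n} (v : Fin n → Fk) j →
                 sumWith _⊕_ 𝟘 v j ≡ sumWith _+_ 0# (λ l → v l j)
  ∑-coordinate {zero}  v j = ≡.refl
  ∑-coordinate {suc n} v j = ≡.cong (v zero j +_) (∑-coordinate (λ l → v (suc l)) j)

  basis-expansion : ∀ x → x ≐ sumWith _⊕_ 𝟘 (λ l → x l ⊙ e l)
  basis-expansion x j = F.sym (begin
    sumWith _⊕_ 𝟘 (λ l → x l ⊙ e l) j   ≡⟨ ∑-coordinate (λ l → x l ⊙ e l) j ⟩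
    sumWith _+_ 0# (λ l → x l * e l j)  ≈⟨ ∑-cong (λ l → F.*-comm (x l) (e l j)) ⟩
    combine x (λ l → e l j)             ≈⟨ combine-delta x (λ l → e l j) j (e-same j)
                                             (λ l j≢l → e-other l j (λ l≡j → j≢l (≡.sym l≡j))) ⟩
    x j                                 ∎)
    where
    open Combination (TensorUnit.⟨module⟩ {R = F})
    open SetoidReasoning F.setoid

  ≐⇒∼ : ∀ {x y} → x ≐ y → x ∼ y
  ≐⇒∼ x≐y = resp (λ l → F.sym (x≈y⇒x∙y⁻¹≈ε (x≐y l))) zer
    where open GroupProperties F.+-group using (x≈y⇒x∙y⁻¹≈ε)

  open Module M using (_≈ᴹ_; 0ᴹ)

  module _ {mH ℓH : Level} (H : Module F mH ℓH) where
    open Module H renaming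
      (Carrierᴹ to Cᴴ; _≈ᴹ_ to _≈ᴴ_; _+ᴹ_ to _+ᴴ_; _*ₗ_ to _*ᴴ_; 0ᴹ to 0ᴴ)
    open Combination H
    open SetoidReasoning ≈ᴹ-setoid
    open GroupProperties +ᴹ-group using (identityˡ-unique)
    open GroupProperties F.+-group using (//-rightDividesˡ)

    record IsLinear (f : Fk → Cᴴ) : Set ℓH where
      field
        cong     : ∀ {x y} → x ≐ y → f x ≈ᴴ f y
        additive : ∀ x y → f (x ⊕ y) ≈ᴴ f x +ᴴ f y
        homog    : ∀ c x → f (c ⊙ x) ≈ᴴ c *ᴴ f x

    module _ {f : Fk → Cᴴ} (lin : IsLinear f) where
      open IsLinear lin

      linear-zero : f 𝟘 ≈ᴴ 0ᴴ
      linear-zero = begin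
        f 𝟘            ≈⟨ cong (λ _ → F.sym (F.zeroˡ 0#)) ⟩
        f (0# ⊙ 𝟘)     ≈⟨ homog 0# 𝟘 ⟩
        0# *ᴴ f 𝟘      ≈⟨ *ₗ-zeroˡ (f 𝟘) ⟩
        0ᴴ             ∎

      linear-∑ : ∀ {n} (v : Fin n → Fk) → f (sumWith _⊕_ 𝟘 v) ≈ᴴ ∑ (λ t → f (v t))
      linear-∑ {zero}  v = linear-zero
      linear-∑ {suc n} v = ≈ᴹ-trans (additive (v zero) _) (+ᴹ-cong ≈ᴹ-refl (linear-∑ (λ t → v (suc t))))

      linear-expand : ∀ x → f x ≈ᴴ combine (λ l → f (e l)) x
      linear-expand x = begin
        f x                                  ≈⟨ cong (basis-expansion x) ⟩
        f (sumWith _⊕_ 𝟘 (λ l → x l ⊙ e l)) ≈⟨ linear-∑ (λ l → x l ⊙ e l) ⟩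
        ∑ (λ l → f (x l ⊙ e l))              ≈⟨ ∑-cong (λ l → homog (x l) (e l)) ⟩
        combine (λ l → f (e l)) x            ∎

      linear-⊖⊕ : ∀ x y → f (x ⊖ y) +ᴴ f y ≈ᴴ f x
      linear-⊖⊕ x y = ≈ᴹ-trans (≈ᴹ-sym (additive (x ⊖ y) y)) (cong (λ l → //-rightDividesˡ (y l) (x l)))

      linear-⊖ : ∀ {x y} → f x ≈ᴴ f y → f (x ⊖ y) ≈ᴴ 0ᴴ
      linear-⊖ {x} {y} fx≈fy = identityˡ-unique (f (x ⊖ y)) (f y) (≈ᴹ-trans (linear-⊖⊕ x y) fx≈fy)

      linear-span : (∀ i j → φ (r i j) ≈ᴹ 0ᴹ → f (r i j) ≈ᴴ 0ᴴ) →
                    ∀ {z} → InSpan z → f z ≈ᴴ 0ᴴ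
      linear-span onGen (gen i j φr≈0) = onGen i j φr≈0
      linear-span onGen zer = linear-zero
      linear-span onGen (add {x} {y} x∈ y∈) = begin
        f (x ⊕ y)    ≈⟨ additive x y ⟩
        f x +ᴴ f y   ≈⟨ +ᴹ-cong (linear-span onGen x∈) (linear-span onGen y∈) ⟩
        0ᴴ +ᴴ 0ᴴ     ≈⟨ +ᴹ-identityˡ 0ᴴ ⟩
        0ᴴ           ∎
      linear-span onGen (scale c {x} x∈) = begin
        f (c ⊙ x)    ≈⟨ homog c x ⟩
        c *ᴴ f x     ≈⟨ *ₗ-cong F.refl (linear-span onGen x∈) ⟩
        c *ᴴ 0ᴴ      ≈⟨ *ₗ-zeroʳ c ⟩
        0ᴴ           ∎
      linear-span onGen (resp x≐y x∈) = ≈ᴹ-trans (cong (λ l → F.sym (x≐y l))) (linear-span onGen x∈)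

      linear-descends : (∀ {z} → InSpan z → f z ≈ᴴ 0ᴴ) → ∀ {x y} → x ∼ y → f x ≈ᴴ f y
      linear-descends kills {x} {y} x∼y = begin
        f x                  ≈⟨ linear-⊖⊕ x y ⟨
        f (x ⊖ y) +ᴴ f y     ≈⟨ +ᴹ-cong (kills x∼y) ≈ᴹ-refl ⟩
        0ᴴ +ᴴ f y            ≈⟨ +ᴹ-identityˡ (f y) ⟩
        f y                  ∎

    combine-isLinear : (v : Fin k → Cᴴ) → IsLinear (combine v)
    combine-isLinear v = record
      { cong = combine-cong v ; additive = combine-+ v ; homog = combine-* v }

    combine-basis : (v : Fin k → Cᴴ) → ∀ i → combine v (e i) ≈ᴴ v i
    combine-basis v i = combine-delta v (e i) i (e-same i) (e-other i)

    extend : FreimanHom H → LinearMap H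
    extend g = record
      { fun      = combine v
      ; wellDef  = linear-descends lin (linear-span lin killsGenerators)
      ; additive = combine-+ v
      ; homog    = combine-* v
      }
      where
      open FreimanHom g renaming (fun to v)
      lin = combine-isLinear v
      onBasisSum : ∀ i → combine v (sumWith _⊕_ 𝟘 (λ t → e (i t))) ≈ᴴ ∑ (λ t → v (i t))
      onBasisSum i = ≈ᴹ-trans (linear-∑ lin (λ t → e (i t))) (∑-cong (λ t → combine-basis v (i t)))
      killsGenerators : ∀ i j → φ (r i j) ≈ᴹ 0ᴹ → combine v (r i j) ≈ᴴ 0ᴴ
      killsGenerators i j φr≈0 = linear-⊖ lin (begin
        combine v (sumWith _⊕_ 𝟘 (λ t → e (i t)))  ≈⟨ onBasisSum i ⟩
        ∑ (λ t → v (i t))                           ≈⟨ freiman i j (gen i j φr≈0) ⟩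
        ∑ (λ t → v (j t))                           ≈⟨ onBasisSum j ⟨
        combine v (sumWith _⊕_ 𝟘 (λ t → e (j t)))  ∎)

    extend-injective : ∀ g g′ → (∀ x → LinearMap.fun (extend g) x ≈ᴴ LinearMap.fun (extend g′) x) →
                       ∀ i → FreimanHom.fun g i ≈ᴴ FreimanHom.fun g′ i
    extend-injective g g′ g̃≈g̃′ i = begin
      FreimanHom.fun g i                  ≈⟨ combine-basis (FreimanHom.fun g) i ⟨
      LinearMap.fun (extend g) (e i)      ≈⟨ g̃≈g̃′ (e i) ⟩
      LinearMap.fun (extend g′) (e i)     ≈⟨ combine-basis (FreimanHom.fun g′) i ⟩
      FreimanHom.fun g′ i                 ∎

    linearMap-isLinear : (L : LinearMap H) → IsLinear (LinearMap.fun L)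
    linearMap-isLinear L = record
      { cong     = λ x≐y → wellDef (≐⇒∼ x≐y)
      ; additive = additive
      ; homog    = homog
      }
      where open LinearMap L

    restrict : LinearMap H → FreimanHom H
    restrict L = record
      { fun     = λ i → LinearMap.fun L (e i)
      ; freiman = λ i j sums∼ → begin
          ∑ (λ t → LinearMap.fun L (e (i t)))             ≈⟨ linear-∑ lin (λ t → e (i t)) ⟨
          LinearMap.fun L (sumWith _⊕_ 𝟘 (λ t → e (i t))) ≈⟨ LinearMap.wellDef L sums∼ ⟩
          LinearMap.fun L (sumWith _⊕_ 𝟘 (λ t → e (j t))) ≈⟨ linear-∑ lin (λ t → e (j t)) ⟩
          ∑ (λ t → LinearMap.fun L (e (j t)))             ∎
      }
      where lin = linearMap-isLinear L

    extend-restrict : ∀ L x → LinearMap.fun (extend (restrict L)) x ≈ᴴ LinearMap.fun L x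
    extend-restrict L x = ≈ᴹ-sym (linear-expand (linearMap-isLinear L) x)

lemma2 : {mM ℓM mH ℓH : Level} →
  (c : Coeff) →
  (M : Module (ring c) mM ℓM) →
  (s : ℕ) → 0 < s →
  (k : ℕ) → (a : Fin k → Module.Carrierᴹ M) →
  (∀ i j → Module._≈ᴹ_ M (a i) (a j) → i ≡ j) →
  (H : Module (ring c) mH ℓH) →
  let open Construction (ring c) M k a s
      Carrier = CommutativeRing.Carrier (ring c)
      _≈ᴴ_ = Module._≈ᴹ_ H
      _+ᴴ_ = Module._+ᴹ_ H
      _*ᴴ_ = Module._*ₗ_ H
      gfun = FreimanHom.fun {H = H}
      lfun = LinearMap.fun {H = H}
  in Σ (FreimanHom H → LinearMap H) λ ext →
       (∀ g i → lfun (ext g) (e i) ≈ᴴ gfun g i)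
     × (∀ g g′ g″ → (∀ i → gfun g″ i ≈ᴴ (gfun g i +ᴴ gfun g′ i)) →
          ∀ x → lfun (ext g″) x ≈ᴴ (lfun (ext g) x +ᴴ lfun (ext g′) x))
     × (∀ (λ′ : Carrier) g g′ → (∀ i → gfun g′ i ≈ᴴ (λ′ *ᴴ gfun g i)) →
          ∀ x → lfun (ext g′) x ≈ᴴ (λ′ *ᴴ lfun (ext g) x))
     × (∀ g g′ → (∀ x → lfun (ext g) x ≈ᴴ lfun (ext g′) x) → ∀ i → gfun g i ≈ᴴ gfun g′ i)
     × (∀ L → Σ (FreimanHom H) λ g → ∀ x → lfun (ext g) x ≈ᴴ lfun L x)
lemma2 c M s _ k a _ H =
    extend H
  , (λ g → combine-basis H (gfun g))
  , (λ g g′ g″ → combine-+ᵥ (gfun g) (gfun g′) (gfun g″))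
  , (λ λ′ g g′ → combine-*ᵥ λ′ (gfun g) (gfun g′))
  , extend-injective H
  , (λ L → restrict H L , extend-restrict H L)
  where
  open Extension (ring c) M k a s
  open Combination H
  open Construction (ring c) M k a s using (FreimanHom)
  gfun : FreimanHom H → Fin k → Module.Carrierᴹ H
  gfun = FreimanHom.fun
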